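{- Let $H$ be a finite graph containing no triangle. Then $p^4$ divides $\Delta_H(p)$.
   Context: For $p\in[0,1]$ define the kernel $U_p:[0,1]^2\to\mathbb{R}$ by $U_p(x,y)=2p-1$ if $(x,y)\in[0,1/2)^2$ or $(x,y)\in[1/2,1]^2$, and $U_p(x,y)=-1$ otherwise. For a graph $H$, $t_H(U)=\int_{[0,1]^{v(H)}}\prod_{ij\in E(H)}U(x_i,x_j)\prod_i dx_i$, and $\Delta_H(p):=t_H(U_p)-(p-1)^{e(H)}$, a polynomial in $p$; divisibility is in $\mathbb{R}[p]$. -}

module Defs where

open import Data.Bool using (Bool; true; false; _∧_; if_then_else_)
open import Data.Nat using (ℕ; zero; suc; _<ᵇ_)
open import Data.Fin using (Fin; toℕ) renaming (zero to fzero; suc to fsuc)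
open import Data.List using (List; []; _∷_; map; concatMap; allFin; length; foldr)
open import Data.Product using (_×_; _,_; Σ)
open import Data.Rational using (ℚ; 0ℚ; 1ℚ; ½; _+_; _*_; -_)
open import Data.Integer using (+_)
open import Data.Rational using (_/_)
open import Data.Empty using (⊥)
open import Relation.Binary.PropositionalEquality using (_≡_)

-- Polynomials in p with rational coefficients, as coefficient lists
-- (constant term first).  Equality / divisibility are coefficientwise.

Poly : Set
Poly = List ℚ

coeff : Poly → ℕ → ℚ
coeff []      _       = 0ℚ
coeff (a ∷ _) zero    = a
coeff (_ ∷ f) (suc k) = coeff f k

addP : Poly → Poly → Poly
addP []      g       = g
addP f       []      = f
addP (a ∷ f) (b ∷ g) = (a + b) ∷ addP f g

scaleP : ℚ → Poly → Poly
scaleP c = map (c *_)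

mulP : Poly → Poly → Poly
mulP []      g = []
mulP (a ∷ f) g = addP (scaleP a g) (0ℚ ∷ mulP f g)

subP : Poly → Poly → Poly
subP f g = addP f (scaleP (- 1ℚ) g)

constP : ℚ → Poly
constP c = c ∷ []

X : Poly
X = 0ℚ ∷ 1ℚ ∷ []

powP : Poly → ℕ → Poly
powP f zero    = constP 1ℚ
powP f (suc k) = mulP f (powP f k)

-- f divides g in ℚ[p]  (equivalently in ℝ[p] for rational f, g)
_∣P_ : Poly → Poly → Set
f ∣P g = Σ Poly (λ q → ∀ k → coeff (mulP f q) k ≡ coeff g k)

record Graph : Set where
  field
    n       : ℕ
    adj     : Fin n → Fin n → Bool
    adj-sym : ∀ i j → adj i j ≡ adj j i
    adj-irr : ∀ i → adj i i ≡ false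

open Graph public

-- no three pairwise adjacent vertices (irreflexivity forces them distinct)
TriangleFree : Graph → Set
TriangleFree G = ∀ a b c → adj G a b ≡ true → adj G b c ≡ true → adj G a c ≡ true → ⊥

edges : (G : Graph) → List (Fin (n G) × Fin (n G))
edges G = concatMap (λ i → concatMap (λ j →
            if (toℕ i <ᵇ toℕ j) ∧ adj G i j then (i , j) ∷ [] else [])
            (allFin (n G))) (allFin (n G))

e : Graph → ℕ
e G = length (edges G)

-- The step kernel U_p: value depends only on which half each point
-- lies in (false = [0,1/2), true = [1/2,1]).

Uval : Bool → Bool → Poly
Uval false false = (- 1ℚ) ∷ (+ 2 / 1) ∷ []
Uval true  true  = (- 1ℚ) ∷ (+ 2 / 1) ∷ []
Uval false true  = constP (- 1ℚ)
Uval true  false = constP (- 1ℚ)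

consF : ∀ {m} → Bool → (Fin m → Bool) → Fin (suc m) → Bool
consF b σ fzero    = b
consF b σ (fsuc i) = σ i

sumAssign : (m : ℕ) → ((Fin m → Bool) → Poly) → Poly
sumAssign zero    f = f (λ ())
sumAssign (suc m) f = addP (sumAssign m (λ σ → f (consF false σ)))
                           (sumAssign m (λ σ → f (consF true σ)))

prodP : List Poly → Poly
prodP = foldr mulP (constP 1ℚ)

halfPow : ℕ → ℚ
halfPow zero    = 1ℚ
halfPow (suc k) = ½ * halfPow k

-- t_H(U_p): the integral over [0,1]^{v(H)} of the step function,
-- i.e. 2^{-v} Σ_σ Π_{ij ∈ E} U(σ i, σ j)
tU : Graph → Poly
tU G = scaleP (halfPow (n G))
         (sumAssign (n G) (λ σ → prodP (map (λ { (i , j) → Uval (σ i) (σ j) }) (edges G))))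

Δ : Graph → Poly
Δ G = subP (tU G) (powP ((- 1ℚ) ∷ 1ℚ ∷ []) (e G))

-- Write s(x) = ±1 according to the half of [0,1] containing x.  Then U_p(x, y) = (p - 1) + p s(x) s(y),
-- and expanding the product over the edges gives
--   t_H(U_p) = Σ_{S ⊆ E(H)} (p - 1)^(e(H) - |S|) p^|S| 𝔼[Π_v s(x_v)^(deg_S v)],
-- where the expectation is 1 if every vertex has even degree in S and 0 otherwise.  The term S = ∅ is
-- (p - 1)^e(H).  A nonempty edge set with all degrees even has at least three edges, and exactly three
-- only when it is a triangle; so in a triangle-free graph every other term is divisible by p⁴.  The
-- whole computation is carried out in ℚ[p]/(p⁴), where Δ_H becomes 0.
module Submission where

open import Defs
open import Data.Bool using (Bool; true; false; not; _∧_; _xor_; if_then_else_; T)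
open import Data.Nat using (ℕ; zero; suc; _<_; _<ᵇ_; z<s; s<s)
open import Data.List using (List; []; _∷_; _++_; map; length; concatMap; allFin; replicate; drop)
open import Data.Rational using (ℚ; 0ℚ; 1ℚ; ½; _+_; _*_; -_)
open import Relation.Binary.PropositionalEquality
  using (_≡_; _≢_; refl; sym; trans; cong; cong₂; subst; _≗_; module ≡-Reasoning)

-- The ring laws are proved componentwise by the ring solver, which is kept out of the scope of
-- the overloaded list constructors used below.
module TruncatedPolynomials where

  open import Level using (0ℓ)
  open import Data.Maybe using (Maybe; just; nothing)
  open import Data.Rational.Properties using (+-*-commutativeRing; +-identityˡ; +-identityʳ; *-zeroʳ; _≟_)
  open import Relation.Nullary using (yes; no)
  open import Tactic.RingSolver using (solve)
  open import Tactic.RingSolver.Core.AlmostCommutativeRing using (AlmostCommutativeRing; fromCommutativeRing)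

  ℚ-ring : AlmostCommutativeRing 0ℓ 0ℓ
  ℚ-ring = fromCommutativeRing +-*-commutativeRing isZero
    where
    isZero : ∀ x → Maybe (0ℚ ≡ x)
    isZero x with 0ℚ ≟ x
    ... | yes p = just p
    ... | no _  = nothing

  -- ℚ[p]/(p⁴).  Without η the solver sees the components of nested operations in normal form.
  record Poly₄ : Set where
    no-eta-equality
    pattern
    constructor poly₄
    field c₀ c₁ c₂ c₃ : ℚ

  infixl 6 _+₄_
  infixl 7 _*₄_ _·₄_

  _+₄_ : Poly₄ → Poly₄ → Poly₄
  poly₄ a₀ a₁ a₂ a₃ +₄ poly₄ b₀ b₁ b₂ b₃ = poly₄ (a₀ + b₀) (a₁ + b₁) (a₂ + b₂) (a₃ + b₃)

  _*₄_ : Poly₄ → Poly₄ → Poly₄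
  poly₄ a₀ a₁ a₂ a₃ *₄ poly₄ b₀ b₁ b₂ b₃ =
    poly₄ (a₀ * b₀) (a₀ * b₁ + a₁ * b₀) (a₀ * b₂ + a₁ * b₁ + a₂ * b₀)
          (a₀ * b₃ + a₁ * b₂ + a₂ * b₁ + a₃ * b₀)

  _·₄_ : ℚ → Poly₄ → Poly₄
  q ·₄ poly₄ a₀ a₁ a₂ a₃ = poly₄ (q * a₀) (q * a₁) (q * a₂) (q * a₃)

  0₄ 1₄ : Poly₄
  0₄ = poly₄ 0ℚ 0ℚ 0ℚ 0ℚ
  1₄ = poly₄ 1ℚ 0ℚ 0ℚ 0ℚ

  shift : Poly₄ → Poly₄
  shift (poly₄ a₀ a₁ a₂ _) = poly₄ 0ℚ a₀ a₁ a₂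

  poly₄-cong : ∀ {a₀ a₁ a₂ a₃ b₀ b₁ b₂ b₃} → a₀ ≡ b₀ → a₁ ≡ b₁ → a₂ ≡ b₂ → a₃ ≡ b₃ →
               poly₄ a₀ a₁ a₂ a₃ ≡ poly₄ b₀ b₁ b₂ b₃
  poly₄-cong refl refl refl refl = refl

  +-identityʳ₄ : ∀ x → x +₄ 0₄ ≡ x
  +-identityʳ₄ (poly₄ a₀ a₁ a₂ a₃) =
    poly₄-cong (+-identityʳ a₀) (+-identityʳ a₁) (+-identityʳ a₂) (+-identityʳ a₃)

  +-interchange₄ : ∀ w x y z → (w +₄ x) +₄ (y +₄ z) ≡ (w +₄ y) +₄ (x +₄ z)
  +-interchange₄ (poly₄ a₀ a₁ a₂ a₃) (poly₄ b₀ b₁ b₂ b₃) (poly₄ c₀ c₁ c₂ c₃) (poly₄ d₀ d₁ d₂ d₃) =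
    poly₄-cong (solve (a₀ ∷ b₀ ∷ c₀ ∷ d₀ ∷ []) ℚ-ring) (solve (a₁ ∷ b₁ ∷ c₁ ∷ d₁ ∷ []) ℚ-ring)
               (solve (a₂ ∷ b₂ ∷ c₂ ∷ d₂ ∷ []) ℚ-ring) (solve (a₃ ∷ b₃ ∷ c₃ ∷ d₃ ∷ []) ℚ-ring)

  *-zeroˡ₄ : ∀ x → 0₄ *₄ x ≡ 0₄
  *-zeroˡ₄ (poly₄ a₀ a₁ a₂ a₃) =
    poly₄-cong (solve (a₀ ∷ []) ℚ-ring) (solve (a₀ ∷ a₁ ∷ []) ℚ-ring)
               (solve (a₀ ∷ a₁ ∷ a₂ ∷ []) ℚ-ring) (solve (a₀ ∷ a₁ ∷ a₂ ∷ a₃ ∷ []) ℚ-ring)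

  -- multiplication by a + p t, the recursion behind mulP
  *-unfoldˡ₄ : ∀ a t₀ t₁ t₂ t₃ y →
               poly₄ a t₀ t₁ t₂ *₄ y ≡ a ·₄ y +₄ shift (poly₄ t₀ t₁ t₂ t₃ *₄ y)
  *-unfoldˡ₄ a t₀ t₁ t₂ t₃ (poly₄ b₀ b₁ b₂ b₃) =
    poly₄-cong (solve (a ∷ b₀ ∷ []) ℚ-ring) (solve (a ∷ t₀ ∷ b₀ ∷ b₁ ∷ []) ℚ-ring)
               (solve (a ∷ t₀ ∷ t₁ ∷ b₀ ∷ b₁ ∷ b₂ ∷ []) ℚ-ring)
               (solve (a ∷ t₀ ∷ t₁ ∷ t₂ ∷ b₀ ∷ b₁ ∷ b₂ ∷ b₃ ∷ []) ℚ-ring)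

  *-distribˡ-+₄ : ∀ x y z → x *₄ (y +₄ z) ≡ x *₄ y +₄ x *₄ z
  *-distribˡ-+₄ (poly₄ a₀ a₁ a₂ a₃) (poly₄ b₀ b₁ b₂ b₃) (poly₄ c₀ c₁ c₂ c₃) =
    poly₄-cong (solve (a₀ ∷ b₀ ∷ c₀ ∷ []) ℚ-ring) (solve (a₀ ∷ a₁ ∷ b₀ ∷ b₁ ∷ c₀ ∷ c₁ ∷ []) ℚ-ring)
               (solve (a₀ ∷ a₁ ∷ a₂ ∷ b₀ ∷ b₁ ∷ b₂ ∷ c₀ ∷ c₁ ∷ c₂ ∷ []) ℚ-ring)
               (solve (a₀ ∷ a₁ ∷ a₂ ∷ a₃ ∷ b₀ ∷ b₁ ∷ b₂ ∷ b₃ ∷ c₀ ∷ c₁ ∷ c₂ ∷ c₃ ∷ []) ℚ-ring)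

  *-distribʳ-+₄ : ∀ x y z → (y +₄ z) *₄ x ≡ y *₄ x +₄ z *₄ x
  *-distribʳ-+₄ (poly₄ a₀ a₁ a₂ a₃) (poly₄ b₀ b₁ b₂ b₃) (poly₄ c₀ c₁ c₂ c₃) =
    poly₄-cong (solve (a₀ ∷ b₀ ∷ c₀ ∷ []) ℚ-ring) (solve (a₀ ∷ a₁ ∷ b₀ ∷ b₁ ∷ c₀ ∷ c₁ ∷ []) ℚ-ring)
               (solve (a₀ ∷ a₁ ∷ a₂ ∷ b₀ ∷ b₁ ∷ b₂ ∷ c₀ ∷ c₁ ∷ c₂ ∷ []) ℚ-ring)
               (solve (a₀ ∷ a₁ ∷ a₂ ∷ a₃ ∷ b₀ ∷ b₁ ∷ b₂ ∷ b₃ ∷ c₀ ∷ c₁ ∷ c₂ ∷ c₃ ∷ []) ℚ-ring)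

  ·-distrib-+₄ : ∀ q x y → q ·₄ (x +₄ y) ≡ q ·₄ x +₄ q ·₄ y
  ·-distrib-+₄ q (poly₄ a₀ a₁ a₂ a₃) (poly₄ b₀ b₁ b₂ b₃) =
    poly₄-cong (solve (q ∷ a₀ ∷ b₀ ∷ []) ℚ-ring) (solve (q ∷ a₁ ∷ b₁ ∷ []) ℚ-ring)
               (solve (q ∷ a₂ ∷ b₂ ∷ []) ℚ-ring) (solve (q ∷ a₃ ∷ b₃ ∷ []) ℚ-ring)

  ·-*-commute₄ : ∀ q x y → q ·₄ (x *₄ y) ≡ x *₄ (q ·₄ y)
  ·-*-commute₄ q (poly₄ a₀ a₁ a₂ a₃) (poly₄ b₀ b₁ b₂ b₃) =
    poly₄-cong (solve (q ∷ a₀ ∷ b₀ ∷ []) ℚ-ring) (solve (q ∷ a₀ ∷ a₁ ∷ b₀ ∷ b₁ ∷ []) ℚ-ring)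
               (solve (q ∷ a₀ ∷ a₁ ∷ a₂ ∷ b₀ ∷ b₁ ∷ b₂ ∷ []) ℚ-ring)
               (solve (q ∷ a₀ ∷ a₁ ∷ a₂ ∷ a₃ ∷ b₀ ∷ b₁ ∷ b₂ ∷ b₃ ∷ []) ℚ-ring)

  ·-*-assoc₄ : ∀ q x y → (q ·₄ x) *₄ y ≡ q ·₄ (x *₄ y)
  ·-*-assoc₄ q (poly₄ a₀ a₁ a₂ a₃) (poly₄ b₀ b₁ b₂ b₃) =
    poly₄-cong (solve (q ∷ a₀ ∷ b₀ ∷ []) ℚ-ring) (solve (q ∷ a₀ ∷ a₁ ∷ b₀ ∷ b₁ ∷ []) ℚ-ring)
               (solve (q ∷ a₀ ∷ a₁ ∷ a₂ ∷ b₀ ∷ b₁ ∷ b₂ ∷ []) ℚ-ring)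
               (solve (q ∷ a₀ ∷ a₁ ∷ a₂ ∷ a₃ ∷ b₀ ∷ b₁ ∷ b₂ ∷ b₃ ∷ []) ℚ-ring)

  ·-identityˡ₄ : ∀ x → 1ℚ ·₄ x ≡ x
  ·-identityˡ₄ (poly₄ a₀ a₁ a₂ a₃) =
    poly₄-cong (solve (a₀ ∷ []) ℚ-ring) (solve (a₁ ∷ []) ℚ-ring)
               (solve (a₂ ∷ []) ℚ-ring) (solve (a₃ ∷ []) ℚ-ring)

  -·-involutive₄ : ∀ x → (- 1ℚ) ·₄ ((- 1ℚ) ·₄ x) ≡ x
  -·-involutive₄ (poly₄ a₀ a₁ a₂ a₃) =
    poly₄-cong (solve (a₀ ∷ []) ℚ-ring) (solve (a₁ ∷ []) ℚ-ring)
               (solve (a₂ ∷ []) ℚ-ring) (solve (a₃ ∷ []) ℚ-ring)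

  +-inverseʳ₄ : ∀ x → x +₄ (- 1ℚ) ·₄ x ≡ 0₄
  +-inverseʳ₄ (poly₄ a₀ a₁ a₂ a₃) =
    poly₄-cong (solve (a₀ ∷ []) ℚ-ring) (solve (a₁ ∷ []) ℚ-ring)
               (solve (a₂ ∷ []) ℚ-ring) (solve (a₃ ∷ []) ℚ-ring)

  ·-zeroʳ₄ : ∀ q → q ·₄ 0₄ ≡ 0₄
  ·-zeroʳ₄ q = poly₄-cong (*-zeroʳ q) (*-zeroʳ q) (*-zeroʳ q) (*-zeroʳ q)

  ·-halve₄ : ∀ q x → (½ * q) ·₄ (x +₄ x) ≡ q ·₄ x
  ·-halve₄ q (poly₄ a₀ a₁ a₂ a₃) =
    poly₄-cong (solve (q ∷ a₀ ∷ []) ℚ-ring) (solve (q ∷ a₁ ∷ []) ℚ-ring)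
               (solve (q ∷ a₂ ∷ []) ℚ-ring) (solve (q ∷ a₃ ∷ []) ℚ-ring)

  shift-+₄ : ∀ x y → shift (x +₄ y) ≡ shift x +₄ shift y
  shift-+₄ (poly₄ a₀ a₁ a₂ a₃) (poly₄ b₀ b₁ b₂ b₃) =
    poly₄-cong (sym (+-identityˡ 0ℚ)) refl refl refl

  shift-*₄ : ∀ x y → x *₄ shift y ≡ shift (x *₄ y)
  shift-*₄ (poly₄ a₀ a₁ a₂ a₃) (poly₄ b₀ b₁ b₂ b₃) =
    poly₄-cong (solve (a₀ ∷ []) ℚ-ring) (solve (a₀ ∷ a₁ ∷ b₀ ∷ []) ℚ-ring)
               (solve (a₀ ∷ a₁ ∷ a₂ ∷ b₀ ∷ b₁ ∷ []) ℚ-ring)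
               (solve (a₀ ∷ a₁ ∷ a₂ ∷ a₃ ∷ b₀ ∷ b₁ ∷ b₂ ∷ []) ℚ-ring)

  X₄ X₄-1 : Poly₄
  X₄   = poly₄ 0ℚ 1ℚ 0ℚ 0ℚ
  X₄-1 = poly₄ (- 1ℚ) 1ℚ 0ℚ 0ℚ

  X₄-*₄ : ∀ x → X₄ *₄ x ≡ shift x
  X₄-*₄ (poly₄ a₀ a₁ a₂ a₃) =
    poly₄-cong (solve (a₀ ∷ []) ℚ-ring) (solve (a₀ ∷ a₁ ∷ []) ℚ-ring)
               (solve (a₀ ∷ a₁ ∷ a₂ ∷ []) ℚ-ring) (solve (a₀ ∷ a₁ ∷ a₂ ∷ a₃ ∷ []) ℚ-ring)

  _^₄_ : Poly₄ → ℕ → Poly₄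
  x ^₄ zero  = 1₄
  x ^₄ suc k = x *₄ x ^₄ k

open TruncatedPolynomials

open import Data.Bool.Properties using (not-involutive; xor-assoc)
open import Data.Nat.Properties using (<-asym; <ᵇ⇒<)
open import Data.Fin using (Fin; toℕ; _≟_) renaming (zero to fzero; suc to fsuc)
open import Data.List.Relation.Unary.All as All using (All; []; _∷_)
import Data.List.Relation.Unary.All.Properties as Allₚ
open import Data.List.Relation.Unary.AllPairs as AllPairs using ([]; _∷_)
import Data.List.Relation.Unary.AllPairs.Properties as AllPairsₚ
open import Data.List.Relation.Unary.Unique.Propositional using (Unique)
import Data.List.Relation.Unary.Unique.Propositional.Properties as Unique
open import Data.List.Relation.Binary.Disjoint.Propositional using (Disjoint)
open import Data.List.Relation.Binary.Sublist.Propositional using (_⊆_; []; _∷_; _∷ʳ_)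
open import Data.List.Relation.Binary.Sublist.Propositional.Properties using (All-resp-⊆)
open import Data.Product using (_×_; _,_; proj₁; proj₂)
open import Data.Sum using (_⊎_; inj₁; inj₂)
open import Data.Empty using (⊥-elim)
open import Data.Rational.Properties using (+-identityˡ; +-identityʳ; *-zeroˡ; *-zeroʳ; *-identityˡ)
open import Relation.Nullary using (¬_; does; yes; no)
open import Relation.Nullary.Decidable using (dec-true; dec-false)

coeff-addP : ∀ f g k → coeff (addP f g) k ≡ coeff f k + coeff g k
coeff-addP []      g       k       = sym (+-identityˡ _)
coeff-addP (a ∷ f) []      k       = sym (+-identityʳ _)
coeff-addP (a ∷ f) (b ∷ g) zero    = refl
coeff-addP (a ∷ f) (b ∷ g) (suc k) = coeff-addP f g k

coeff-scaleP : ∀ c f k → coeff (scaleP c f) k ≡ c * coeff f k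
coeff-scaleP c []      k       = sym (*-zeroʳ c)
coeff-scaleP c (a ∷ f) zero    = refl
coeff-scaleP c (a ∷ f) (suc k) = coeff-scaleP c f k

truncate : Poly → Poly₄
truncate f = poly₄ (coeff f 0) (coeff f 1) (coeff f 2) (coeff f 3)

truncate-addP : ∀ f g → truncate (addP f g) ≡ truncate f +₄ truncate g
truncate-addP f g =
  poly₄-cong (coeff-addP f g 0) (coeff-addP f g 1) (coeff-addP f g 2) (coeff-addP f g 3)

truncate-scaleP : ∀ c f → truncate (scaleP c f) ≡ c ·₄ truncate f
truncate-scaleP c f =
  poly₄-cong (coeff-scaleP c f 0) (coeff-scaleP c f 1) (coeff-scaleP c f 2) (coeff-scaleP c f 3)

truncate-mulP : ∀ f g → truncate (mulP f g) ≡ truncate f *₄ truncate g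
truncate-mulP []      g = sym (*-zeroˡ₄ (truncate g))
truncate-mulP (a ∷ f) g = begin
  truncate (addP (scaleP a g) (0ℚ ∷ mulP f g))
    ≡⟨ truncate-addP (scaleP a g) (0ℚ ∷ mulP f g) ⟩
  truncate (scaleP a g) +₄ shift (truncate (mulP f g))
    ≡⟨ cong₂ (λ u v → u +₄ shift v) (truncate-scaleP a g) (truncate-mulP f g) ⟩
  a ·₄ truncate g +₄ shift (truncate f *₄ truncate g)
    ≡⟨ sym (*-unfoldˡ₄ a (coeff f 0) (coeff f 1) (coeff f 2) (coeff f 3) (truncate g)) ⟩
  truncate (a ∷ f) *₄ truncate g ∎
  where open ≡-Reasoning

truncate-powP : ∀ f k → truncate (powP f k) ≡ truncate f ^₄ k
truncate-powP f zero    = refl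
truncate-powP f (suc k) =
  trans (truncate-mulP f (powP f k)) (cong (truncate f *₄_) (truncate-powP f k))

coeff-mulP-[] : ∀ f k → coeff (mulP f []) k ≡ 0ℚ
coeff-mulP-[] []      k       = refl
coeff-mulP-[] (a ∷ f) zero    = refl
coeff-mulP-[] (a ∷ f) (suc k) = coeff-mulP-[] f k

coeff-mulP-1 : ∀ g k → coeff (mulP (1ℚ ∷ []) g) k ≡ coeff g k
coeff-mulP-1 g k = begin
  coeff (addP (scaleP 1ℚ g) (0ℚ ∷ [])) k   ≡⟨ coeff-addP (scaleP 1ℚ g) (0ℚ ∷ []) k ⟩
  coeff (scaleP 1ℚ g) k + coeff (0ℚ ∷ []) k ≡⟨ cong₂ _+_ (coeff-scaleP 1ℚ g k) (coeff-0 k) ⟩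
  1ℚ * coeff g k + 0ℚ                       ≡⟨ +-identityʳ (1ℚ * coeff g k) ⟩
  1ℚ * coeff g k                            ≡⟨ *-identityˡ (coeff g k) ⟩
  coeff g k                                 ∎
  where
  open ≡-Reasoning
  coeff-0 : ∀ k → coeff (0ℚ ∷ []) k ≡ 0ℚ
  coeff-0 zero    = refl
  coeff-0 (suc k) = refl

coeff-mulP-0∷ : ∀ f g k → coeff (mulP (0ℚ ∷ f) g) k ≡ coeff (0ℚ ∷ mulP f g) k
coeff-mulP-0∷ f g k = begin
  coeff (addP (scaleP 0ℚ g) (0ℚ ∷ mulP f g)) k
    ≡⟨ coeff-addP (scaleP 0ℚ g) (0ℚ ∷ mulP f g) k ⟩
  coeff (scaleP 0ℚ g) k + coeff (0ℚ ∷ mulP f g) k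
    ≡⟨ cong (_+ coeff (0ℚ ∷ mulP f g) k) (trans (coeff-scaleP 0ℚ g k) (*-zeroˡ (coeff g k))) ⟩
  0ℚ + coeff (0ℚ ∷ mulP f g) k
    ≡⟨ +-identityˡ (coeff (0ℚ ∷ mulP f g) k) ⟩
  coeff (0ℚ ∷ mulP f g) k ∎
  where open ≡-Reasoning

monomial : ℕ → Poly
monomial m = replicate m 0ℚ ++ 1ℚ ∷ []

monomial-∣P : ∀ m f → (∀ k → k < m → coeff f k ≡ 0ℚ) → monomial m ∣P f
monomial-∣P m f low = drop m f , quotient-correct m f low
  where
  quotient-correct : ∀ m f → (∀ k → k < m → coeff f k ≡ 0ℚ) →
                     ∀ k → coeff (mulP (monomial m) (drop m f)) k ≡ coeff f k
  quotient-correct zero    f       low k       = coeff-mulP-1 f k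
  quotient-correct (suc m) f       low zero    =
    trans (coeff-mulP-0∷ (monomial m) (drop (suc m) f) 0) (sym (low 0 z<s))
  quotient-correct (suc m) []      low (suc k) =
    trans (coeff-mulP-0∷ (monomial m) [] (suc k)) (coeff-mulP-[] (monomial m) k)
  quotient-correct (suc m) (a ∷ f) low (suc k) =
    trans (coeff-mulP-0∷ (monomial m) (drop m f) (suc k))
          (quotient-correct m f (λ k k<m → low (suc k) (s<s k<m)) k)

truncate≡0₄⇒X⁴∣P : ∀ f → truncate f ≡ 0₄ → powP X 4 ∣P f
truncate≡0₄⇒X⁴∣P f eq = monomial-∣P 4 f low    -- powP X 4 evaluates to monomial 4
  where
  low : ∀ k → k < 4 → coeff f k ≡ 0ℚ
  low zero                   _ = cong Poly₄.c₀ eq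
  low (suc zero)             _ = cong Poly₄.c₁ eq
  low (suc (suc zero))       _ = cong Poly₄.c₂ eq
  low (suc (suc (suc zero))) _ = cong Poly₄.c₃ eq
  low (suc (suc (suc (suc k)))) (s<s (s<s (s<s (s<s ()))))

Σ₄ : (m : ℕ) → ((Fin m → Bool) → Poly₄) → Poly₄
Σ₄ zero    f = f (λ ())
Σ₄ (suc m) f = Σ₄ m (λ σ → f (consF false σ)) +₄ Σ₄ m (λ σ → f (consF true σ))

truncate-sumAssign : ∀ m f → truncate (sumAssign m f) ≡ Σ₄ m (λ σ → truncate (f σ))
truncate-sumAssign zero    f = refl
truncate-sumAssign (suc m) f =
  trans (truncate-addP (sumAssign m (λ σ → f (consF false σ))) (sumAssign m (λ σ → f (consF true σ))))
        (cong₂ _+₄_ (truncate-sumAssign m (λ σ → f (consF false σ)))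
                    (truncate-sumAssign m (λ σ → f (consF true σ))))

Σ₄-cong : ∀ m {f g} → (∀ σ → f σ ≡ g σ) → Σ₄ m f ≡ Σ₄ m g
Σ₄-cong zero    f≗g = f≗g _
Σ₄-cong (suc m) f≗g = cong₂ _+₄_ (Σ₄-cong m (λ σ → f≗g _)) (Σ₄-cong m (λ σ → f≗g _))

Σ₄-+ : ∀ m f g → Σ₄ m (λ σ → f σ +₄ g σ) ≡ Σ₄ m f +₄ Σ₄ m g
Σ₄-+ zero    f g = refl
Σ₄-+ (suc m) f g =
  trans (cong₂ _+₄_ (Σ₄-+ m (λ σ → f (consF false σ)) (λ σ → g (consF false σ)))
                    (Σ₄-+ m (λ σ → f (consF true σ)) (λ σ → g (consF true σ))))
        (+-interchange₄ _ _ _ _)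

Σ₄-*ˡ : ∀ m x f → Σ₄ m (λ σ → x *₄ f σ) ≡ x *₄ Σ₄ m f
Σ₄-*ˡ zero    x f = refl
Σ₄-*ˡ (suc m) x f =
  trans (cong₂ _+₄_ (Σ₄-*ˡ m x (λ σ → f (consF false σ))) (Σ₄-*ˡ m x (λ σ → f (consF true σ))))
        (sym (*-distribˡ-+₄ x _ _))

Σ₄-·ˡ : ∀ m q f → Σ₄ m (λ σ → q ·₄ f σ) ≡ q ·₄ Σ₄ m f
Σ₄-·ˡ zero    q f = refl
Σ₄-·ˡ (suc m) q f =
  trans (cong₂ _+₄_ (Σ₄-·ˡ m q (λ σ → f (consF false σ))) (Σ₄-·ˡ m q (λ σ → f (consF true σ))))
        (sym (·-distrib-+₄ q _ _))

mean : (n : ℕ) → ((Fin n → Bool) → Poly₄) → Poly₄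
mean n f = halfPow n ·₄ Σ₄ n f

mean-+ : ∀ n f g → mean n (λ σ → f σ +₄ g σ) ≡ mean n f +₄ mean n g
mean-+ n f g = trans (cong (halfPow n ·₄_) (Σ₄-+ n f g)) (·-distrib-+₄ (halfPow n) _ _)

mean-*ˡ : ∀ n x f → mean n (λ σ → x *₄ f σ) ≡ x *₄ mean n f
mean-*ˡ n x f = trans (cong (halfPow n ·₄_) (Σ₄-*ˡ n x f)) (·-*-commute₄ (halfPow n) x _)

signed : Bool → Poly₄ → Poly₄
signed false x = x
signed true  x = (- 1ℚ) ·₄ x

signed-not : ∀ s x → signed (not s) x ≡ (- 1ℚ) ·₄ signed s x
signed-not false x = refl
signed-not true  x = sym (-·-involutive₄ x)

signed-signed : ∀ s t x → signed s (signed t x) ≡ signed (t xor s) x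
signed-signed s     false x = refl
signed-signed false true  x = refl
signed-signed true  true  x = -·-involutive₄ x

signed-+ : ∀ s x y → signed s (x +₄ y) ≡ signed s x +₄ signed s y
signed-+ false x y = refl
signed-+ true  x y = ·-distrib-+₄ (- 1ℚ) x y

signed-*ʳ : ∀ s x y → signed s (x *₄ y) ≡ x *₄ signed s y
signed-*ʳ false x y = refl
signed-*ʳ true  x y = ·-*-commute₄ (- 1ℚ) x y

signed-*ˡ : ∀ s x y → signed s x *₄ y ≡ signed s (x *₄ y)
signed-*ˡ false x y = refl
signed-*ˡ true  x y = ·-*-assoc₄ (- 1ℚ) x y

xor-swap : ∀ x y z → x xor (y xor z) ≡ y xor (x xor z)
xor-swap false y     z = refl
xor-swap true  false z = refl
xor-swap true  true  z = refl

xor-cancelˡ : ∀ x y → x xor (x xor y) ≡ y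
xor-cancelˡ false y = refl
xor-cancelˡ true  y = not-involutive y

xor-pair-cancel : ∀ x y z → x xor (y xor (x xor z)) ≡ y xor z
xor-pair-cancel x y z = trans (xor-swap x y _) (cong (y xor_) (xor-cancelˡ x z))

-- Vertex sets as 𝔽₂-vectors; χ c is the character σ ↦ (-1)^(c · σ) of the sign assignments.
Parity : ℕ → Set
Parity n = Fin n → Bool

∅ : ∀ {n} → Parity n
∅ _ = false

flip : ∀ {n} → Fin n → Parity n → Parity n
flip i c v = does (v ≟ i) xor c v

isEmpty : ∀ {n} → Parity n → Bool
isEmpty {zero}  c = true
isEmpty {suc n} c = not (c fzero) ∧ isEmpty (λ v → c (fsuc v))

χ : ∀ {n} → Parity n → (Fin n → Bool) → Bool
χ {zero}  c σ = false
χ {suc n} c σ = (c fzero ∧ σ fzero) xor χ (λ v → c (fsuc v)) (λ v → σ (fsuc v))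

χ-∅ : ∀ {n} (σ : Fin n → Bool) → χ ∅ σ ≡ false
χ-∅ {zero}  σ = refl
χ-∅ {suc n} σ = χ-∅ (λ v → σ (fsuc v))

χ-flip : ∀ {n} (i : Fin n) c σ → χ (flip i c) σ ≡ σ i xor χ c σ
χ-flip fzero c σ with c fzero | σ fzero
... | false | false = refl
... | false | true  = refl
... | true  | false = refl
... | true  | true  = sym (not-involutive _)
χ-flip (fsuc i) c σ =
  trans (cong ((c fzero ∧ σ fzero) xor_) (χ-flip i (λ v → c (fsuc v)) (λ v → σ (fsuc v))))
        (xor-swap (c fzero ∧ σ fzero) (σ (fsuc i)) _)

mean-character : ∀ n (c : Parity n) x → mean n (λ σ → signed (χ c σ) x) ≡ (if isEmpty c then x else 0₄)
mean-character zero    c x = ·-identityˡ₄ x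
mean-character (suc n) c x with c fzero
... | false = trans (·-halve₄ (halfPow n) S) (mean-character n c′ x)
  where
  c′ = λ v → c (fsuc v)
  S  = Σ₄ n (λ σ → signed (χ c′ σ) x)
... | true = begin
  (½ * halfPow n) ·₄ (S +₄ Σ₄ n (λ σ → signed (not (χ c′ σ)) x))
    ≡⟨ cong (λ t → (½ * halfPow n) ·₄ (S +₄ t))
            (trans (Σ₄-cong n (λ σ → signed-not (χ c′ σ) x)) (Σ₄-·ˡ n (- 1ℚ) _)) ⟩
  (½ * halfPow n) ·₄ (S +₄ (- 1ℚ) ·₄ S)  ≡⟨ cong ((½ * halfPow n) ·₄_) (+-inverseʳ₄ S) ⟩
  (½ * halfPow n) ·₄ 0₄                  ≡⟨ ·-zeroʳ₄ (½ * halfPow n) ⟩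
  0₄                                     ∎
  where
  open ≡-Reasoning
  c′ = λ v → c (fsuc v)
  S  = Σ₄ n (λ σ → signed (χ c′ σ) x)

-- Expansion of t_H(U_p) modulo p⁴

Edge : ℕ → Set
Edge n = Fin n × Fin n

toggle : ∀ {n} → Edge n → Parity n → Parity n
toggle (i , j) c = flip i (flip j c)

-- U_p(x, y) = (p - 1) ± p, with + exactly when x and y lie in the same half
U₄ : Bool → Bool → Poly₄
U₄ x y = X₄-1 +₄ signed (x xor y) X₄

truncate-Uval : ∀ x y → truncate (Uval x y) ≡ U₄ x y
truncate-Uval false false = refl
truncate-Uval false true  = refl
truncate-Uval true  false = refl
truncate-Uval true  true  = refl

U-product : ∀ {n} → (Fin n → Bool) → List (Edge n) → Poly₄
U-product σ []            = 1₄
U-product σ ((i , j) ∷ L) = U₄ (σ i) (σ j) *₄ U-product σ L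

truncate-prodP : ∀ {n} (σ : Fin n → Bool) (g : Edge n → Poly) →
                 (∀ i j → truncate (g (i , j)) ≡ U₄ (σ i) (σ j)) →
                 ∀ L → truncate (prodP (map g L)) ≡ U-product σ L
truncate-prodP σ g g≡U []            = refl
truncate-prodP σ g g≡U ((i , j) ∷ L) =
  trans (truncate-mulP (g (i , j)) (prodP (map g L)))
        (cong₂ _*₄_ (g≡U i j) (truncate-prodP σ g g≡U L))

-- = Σ (p - 1)^(|L| - |S|) p^|S| over the sublists S of L whose set of odd-degree vertices is c
weight : ∀ {n} → List (Edge n) → Parity n → Poly₄
weight []      c = if isEmpty c then 1₄ else 0₄
weight (e ∷ L) c = X₄-1 *₄ weight L c +₄ X₄ *₄ weight L (toggle e c)

signed-U₄ : ∀ s x y z → signed s (U₄ x y *₄ z) ≡ X₄-1 *₄ signed s z +₄ X₄ *₄ signed (x xor (y xor s)) z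
signed-U₄ s x y z = begin
  signed s (U₄ x y *₄ z)
    ≡⟨ cong (signed s) (*-distribʳ-+₄ z X₄-1 (signed (x xor y) X₄)) ⟩
  signed s (X₄-1 *₄ z +₄ signed (x xor y) X₄ *₄ z)
    ≡⟨ signed-+ s _ _ ⟩
  signed s (X₄-1 *₄ z) +₄ signed s (signed (x xor y) X₄ *₄ z)
    ≡⟨ cong₂ _+₄_ (signed-*ʳ s X₄-1 z) (cong (signed s) (signed-*ˡ (x xor y) X₄ z)) ⟩
  X₄-1 *₄ signed s z +₄ signed s (signed (x xor y) (X₄ *₄ z))
    ≡⟨ cong (X₄-1 *₄ signed s z +₄_) (signed-signed s (x xor y) (X₄ *₄ z)) ⟩
  X₄-1 *₄ signed s z +₄ signed ((x xor y) xor s) (X₄ *₄ z)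
    ≡⟨ cong (X₄-1 *₄ signed s z +₄_)
            (trans (cong (λ t → signed t (X₄ *₄ z)) (xor-assoc x y s)) (signed-*ʳ (x xor (y xor s)) X₄ z)) ⟩
  X₄-1 *₄ signed s z +₄ X₄ *₄ signed (x xor (y xor s)) z ∎
  where open ≡-Reasoning

mean-U-product : ∀ n L (c : Parity n) → mean n (λ σ → signed (χ c σ) (U-product σ L)) ≡ weight L c
mean-U-product n []            c = mean-character n c 1₄
mean-U-product n ((i , j) ∷ L) c = begin
  mean n (λ σ → signed (χ c σ) (U₄ (σ i) (σ j) *₄ P σ))
    ≡⟨ cong (halfPow n ·₄_) (Σ₄-cong n expand) ⟩
  mean n (λ σ → X₄-1 *₄ signed (χ c σ) (P σ) +₄ X₄ *₄ signed (χ c′ σ) (P σ))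
    ≡⟨ mean-+ n _ _ ⟩
  mean n (λ σ → X₄-1 *₄ signed (χ c σ) (P σ)) +₄ mean n (λ σ → X₄ *₄ signed (χ c′ σ) (P σ))
    ≡⟨ cong₂ _+₄_ (mean-*ˡ n X₄-1 _) (mean-*ˡ n X₄ _) ⟩
  X₄-1 *₄ mean n (λ σ → signed (χ c σ) (P σ)) +₄ X₄ *₄ mean n (λ σ → signed (χ c′ σ) (P σ))
    ≡⟨ cong₂ (λ u v → X₄-1 *₄ u +₄ X₄ *₄ v) (mean-U-product n L c) (mean-U-product n L c′) ⟩
  weight ((i , j) ∷ L) c ∎
  where
  open ≡-Reasoning
  P  = λ σ → U-product σ L
  c′ = toggle (i , j) c
  χ-toggle : ∀ σ → σ i xor (σ j xor χ c σ) ≡ χ c′ σ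
  χ-toggle σ = sym (trans (χ-flip i (flip j c) σ) (cong (σ i xor_) (χ-flip j c σ)))
  expand : ∀ σ → signed (χ c σ) (U₄ (σ i) (σ j) *₄ P σ) ≡
                 X₄-1 *₄ signed (χ c σ) (P σ) +₄ X₄ *₄ signed (χ c′ σ) (P σ)
  expand σ = trans (signed-U₄ (χ c σ) (σ i) (σ j) (P σ))
                   (cong (λ t → X₄-1 *₄ signed (χ c σ) (P σ) +₄ X₄ *₄ signed t (P σ)) (χ-toggle σ))

-- Divisibility by powers of p

shiftⁿ : ℕ → Poly₄ → Poly₄
shiftⁿ zero    x = x
shiftⁿ (suc r) x = shift (shiftⁿ r x)

record X₄^_∣₄_ (r : ℕ) (x : Poly₄) : Set where
  constructor divides₄
  field
    quotient : Poly₄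
    equation : x ≡ shiftⁿ r quotient

∣₄-0₄ : ∀ r → X₄^ r ∣₄ 0₄
∣₄-0₄ r = divides₄ 0₄ (shiftⁿ-0₄ r)
  where
  shiftⁿ-0₄ : ∀ r → 0₄ ≡ shiftⁿ r 0₄
  shiftⁿ-0₄ zero    = refl
  shiftⁿ-0₄ (suc r) = cong shift (shiftⁿ-0₄ r)

∣₄-+ : ∀ {r x y} → X₄^ r ∣₄ x → X₄^ r ∣₄ y → X₄^ r ∣₄ (x +₄ y)
∣₄-+ {r} (divides₄ u refl) (divides₄ v refl) = divides₄ (u +₄ v) (sym (shiftⁿ-+ r))
  where
  shiftⁿ-+ : ∀ r → shiftⁿ r (u +₄ v) ≡ shiftⁿ r u +₄ shiftⁿ r v
  shiftⁿ-+ zero    = refl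
  shiftⁿ-+ (suc r) = trans (cong shift (shiftⁿ-+ r)) (shift-+₄ (shiftⁿ r u) (shiftⁿ r v))

∣₄-*ˡ : ∀ {r} x {y} → X₄^ r ∣₄ y → X₄^ r ∣₄ (x *₄ y)
∣₄-*ˡ {r} x (divides₄ u refl) = divides₄ (x *₄ u) (shiftⁿ-* r)
  where
  shiftⁿ-* : ∀ r → x *₄ shiftⁿ r u ≡ shiftⁿ r (x *₄ u)
  shiftⁿ-* zero    = refl
  shiftⁿ-* (suc r) = trans (shift-*₄ x (shiftⁿ r u)) (cong shift (shiftⁿ-* r))

∣₄-X₄* : ∀ {r y} → X₄^ r ∣₄ y → X₄^ suc r ∣₄ (X₄ *₄ y)
∣₄-X₄* {r} (divides₄ u refl) = divides₄ u (X₄-*₄ (shiftⁿ r u))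

X₄^4∣₄⇒≡0₄ : ∀ {x} → X₄^ 4 ∣₄ x → x ≡ 0₄
X₄^4∣₄⇒≡0₄ (divides₄ (poly₄ _ _ _ _) refl) = refl

-- the set of vertices of odd degree
∂ : ∀ {n} → List (Edge n) → Parity n
∂ []      = ∅
∂ (e ∷ S) = toggle e (∂ S)

record Even {n} (S : List (Edge n)) : Set where
  constructor even
  field odd-vertices-empty : ∂ S ≗ ∅

toggle-transpose : ∀ {n} (e : Edge n) {c d} → toggle e c ≗ d → c ≗ toggle e d
toggle-transpose (i , j) {c} {d} eq v = begin
  c v
    ≡⟨ sym (xor-cancelˡ [v≟j] (c v)) ⟩
  [v≟j] xor ([v≟j] xor c v)
    ≡⟨ sym (xor-cancelˡ [v≟i] _) ⟩
  [v≟i] xor ([v≟i] xor ([v≟j] xor ([v≟j] xor c v)))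
    ≡⟨ cong ([v≟i] xor_) (xor-swap [v≟i] [v≟j] _) ⟩
  [v≟i] xor ([v≟j] xor ([v≟i] xor ([v≟j] xor c v)))
    ≡⟨ cong (λ b → [v≟i] xor ([v≟j] xor b)) (eq v) ⟩
  [v≟i] xor ([v≟j] xor d v) ∎
  where
  open ≡-Reasoning
  [v≟i] = does (v ≟ i)
  [v≟j] = does (v ≟ j)

isEmpty⇒≗∅ : ∀ {n} (c : Parity n) → isEmpty c ≡ true → c ≗ ∅
isEmpty⇒≗∅ {suc n} c eq v with c fzero in c₀
isEmpty⇒≗∅ {suc n} c eq fzero    | false = c₀
isEmpty⇒≗∅ {suc n} c eq (fsuc v) | false = isEmpty⇒≗∅ (λ w → c (fsuc w)) eq v

isEmpty-∅ : ∀ n → isEmpty {n} ∅ ≡ true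
isEmpty-∅ zero    = refl
isEmpty-∅ (suc n) = isEmpty-∅ n

-- Every term of weight L c comes from a sublist with boundary c and carries its size as a power of p.
weight-divisible : ∀ {n} r (L : List (Edge n)) c →
                   (∀ {S} → S ⊆ L → length S < r → ¬ c ≗ ∂ S) → X₄^ r ∣₄ weight L c
weight-divisible zero    L       c noSub = divides₄ (weight L c) refl
weight-divisible (suc r) []      c noSub with isEmpty c in c≡∅
... | true  = ⊥-elim (noSub [] z<s (isEmpty⇒≗∅ c c≡∅))
... | false = ∣₄-0₄ (suc r)
weight-divisible (suc r) (e ∷ L) c noSub =
  ∣₄-+ (∣₄-*ˡ X₄-1 (weight-divisible (suc r) L c (λ S⊆L → noSub (e ∷ʳ S⊆L))))
       (∣₄-X₄* (weight-divisible r L (toggle e c)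
                 (λ S⊆L |S|<r c≗∂S → noSub (refl ∷ S⊆L) (s<s |S|<r) (toggle-transpose e c≗∂S))))

NoShortEvenSublist : ∀ {n} → List (Edge n) → Set
NoShortEvenSublist L = ∀ {e S} → e ∷ S ⊆ L → length S < 3 → ¬ Even (e ∷ S)

weight-∅ : ∀ {n} (L : List (Edge n)) → NoShortEvenSublist L → weight L ∅ ≡ X₄-1 ^₄ length L
weight-∅ {n} [] _ rewrite isEmpty-∅ n = refl
weight-∅ (e ∷ L) noEven = begin
  X₄-1 *₄ weight L ∅ +₄ X₄ *₄ weight L (toggle e ∅)
    ≡⟨ cong₂ (λ u v → X₄-1 *₄ u +₄ v) (weight-∅ L (λ eS⊆L → noEven (e ∷ʳ eS⊆L))) (X₄^4∣₄⇒≡0₄ p⁴∣) ⟩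
  X₄-1 *₄ X₄-1 ^₄ length L +₄ 0₄
    ≡⟨ +-identityʳ₄ _ ⟩
  X₄-1 ^₄ suc (length L) ∎
  where
  open ≡-Reasoning
  p⁴∣ : X₄^ 4 ∣₄ (X₄ *₄ weight L (toggle e ∅))
  p⁴∣ = ∣₄-X₄* (weight-divisible 3 L (toggle e ∅)
          (λ S⊆L |S|<3 e≗∂S → noEven (refl ∷ S⊆L) |S|<3 (even (λ v → sym (toggle-transpose e e≗∂S v)))))

-- Even edge sets in triangle-free graphs

Even-resp : ∀ {n} {S S′ : List (Edge n)} → (∀ v → ∂ S v ≡ ∂ S′ v) → Even S → Even S′
Even-resp eq (even ∂S≗∅) = even (λ v → trans (sym (eq v)) (∂S≗∅ v))

∂-reverse : ∀ {n} P (i j : Fin n) S → ∂ (P ++ (i , j) ∷ S) ≗ ∂ (P ++ (j , i) ∷ S)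
∂-reverse []            i j S v = xor-swap (does (v ≟ i)) (does (v ≟ j)) (∂ S v)
∂-reverse ((k , l) ∷ P) i j S v =
  cong (λ b → does (v ≟ k) xor (does (v ≟ l) xor b)) (∂-reverse P i j S v)

∂-swap : ∀ {n} P (e e′ : Edge n) S → ∂ (P ++ e ∷ e′ ∷ S) ≗ ∂ (P ++ e′ ∷ e ∷ S)
∂-swap []       (i , j) (k , l) S v =
  trans (cong (I xor_) (xor-swap J K _))
  (trans (xor-swap I K _)
  (cong (K xor_) (trans (cong (I xor_) (xor-swap J L _)) (xor-swap I L _))))
  where
  I = does (v ≟ i)
  J = does (v ≟ j)
  K = does (v ≟ k)
  L = does (v ≟ l)
∂-swap ((k , l) ∷ P) e e′ S v =
  cong (λ b → does (v ≟ k) xor (does (v ≟ l) xor b)) (∂-swap P e e′ S v)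

Even-reverse : ∀ {n} P (i j : Fin n) S → Even (P ++ (i , j) ∷ S) → Even (P ++ (j , i) ∷ S)
Even-reverse P i j S = Even-resp (∂-reverse P i j S)

Even-swap : ∀ {n} P (e e′ : Edge n) S → Even (P ++ e ∷ e′ ∷ S) → Even (P ++ e′ ∷ e ∷ S)
Even-swap P e e′ S = Even-resp (∂-swap P e e′ S)

-- two edges at a have the same boundary as the edge joining their other ends
Even-path : ∀ {n} (a b d : Fin n) S → Even ((a , b) ∷ (a , d) ∷ S) → Even ((b , d) ∷ S)
Even-path a b d S = Even-resp (λ v → xor-pair-cancel (does (v ≟ a)) (does (v ≟ b)) _)

Even-loop : ∀ {n} (b : Fin n) S → Even ((b , b) ∷ S) → Even S
Even-loop b S = Even-resp (λ v → xor-cancelˡ (does (v ≟ b)) (∂ S v))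

_∉ₑ_ : ∀ {n} → Fin n → Edge n → Set
v ∉ₑ (i , j) = v ≢ i × v ≢ j

∂-outside : ∀ {n} {v : Fin n} {S} → All (v ∉ₑ_) S → ∂ S v ≡ false
∂-outside                       []                   = refl
∂-outside {v = v} {(i , j) ∷ S} ((v≢i , v≢j) ∷ v∉S)
  rewrite dec-false (v ≟ i) v≢i | dec-false (v ≟ j) v≢j = ∂-outside v∉S

pendant-¬Even : ∀ {n} {a b : Fin n} {S} → a ≢ b → All (a ∉ₑ_) S → ¬ Even ((a , b) ∷ S)
pendant-¬Even {a = a} {b} {S} a≢b a∉S (even ∂≗∅) = true≢false (begin
  true                                     ≡⟨ sym (cong₂ _xor_ (dec-true (a ≟ a) refl)
                                                 (cong₂ _xor_ (dec-false (a ≟ b) a≢b) (∂-outside a∉S))) ⟩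
  does (a ≟ a) xor (does (a ≟ b) xor ∂ S a) ≡⟨ ∂≗∅ a ⟩
  false ∎)
  where
  open ≡-Reasoning
  true≢false : true ≢ false
  true≢false ()

single-Even⇒loop : ∀ {n} {b d : Fin n} → Even ((b , d) ∷ []) → b ≡ d
single-Even⇒loop {b = b} {d} ev with b ≟ d
... | yes b≡d = b≡d
... | no  b≢d = ⊥-elim (pendant-¬Even b≢d [] ev)

Even-pair : ∀ {n} {a b c d : Fin n} → a ≢ b → Even ((a , b) ∷ (c , d) ∷ []) →
            (a , b) ≡ (c , d) ⊎ (a , b) ≡ (d , c)
Even-pair {a = a} {b} {c} {d} a≢b ev with a ≟ c | a ≟ d
... | yes refl | _ = inj₁ (cong (a ,_) (single-Even⇒loop (Even-path a b d [] ev)))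
... | no _ | yes refl = inj₂ (cong (a ,_) (single-Even⇒loop
  (Even-path a b c [] (Even-reverse ((a , b) ∷ []) c a [] ev))))
... | no a≢c | no a≢d = ⊥-elim (pendant-¬Even a≢b ((a≢c , a≢d) ∷ []) ev)

Adj : (G : Graph) → Fin (n G) → Fin (n G) → Set
Adj G i j = adj G i j ≡ true

Adj-sym : ∀ G {i j} → Adj G i j → Adj G j i
Adj-sym G {i} {j} ij = trans (adj-sym G j i) ij

Adj⇒≢ : ∀ G {i j} → Adj G i j → i ≢ j
Adj⇒≢ G {i} ij refl with trans (sym ij) (adj-irr G i)
... | ()

Even-triangle : ∀ G → TriangleFree G → ∀ {a b d f g} → Adj G a b → Adj G a d → Adj G f g →
                ¬ Even ((a , b) ∷ (a , d) ∷ (f , g) ∷ [])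
Even-triangle G tf {a} {b} {d} {f} {g} ab ad fg ev with b ≟ d | Even-path a b d _ ev
... | yes refl | ev′ = pendant-¬Even (Adj⇒≢ G fg) [] (Even-loop b _ ev′)
... | no  b≢d  | ev′ with Even-pair b≢d ev′
...   | inj₁ refl = tf a b d ab fg ad
...   | inj₂ refl = tf a b d ab (Adj-sym G fg) ad

Even-three-edges : ∀ G → TriangleFree G → ∀ {a b c d f g} → Adj G a b → Adj G c d → Adj G f g →
                   ¬ Even ((a , b) ∷ (c , d) ∷ (f , g) ∷ [])
-- a, having odd degree in (a , b) alone, lies on another edge; move that edge next to (a , b) as (a , _).
Even-three-edges G tf {a} {b} {c} {d} {f} {g} ab cd fg ev with a ≟ c
... | yes refl = Even-triangle G tf ab cd fg ev
... | no a≢c with a ≟ d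
... | yes refl = Even-triangle G tf ab (Adj-sym G cd) fg (Even-reverse ((a , b) ∷ []) c a _ ev)
... | no a≢d with a ≟ f
... | yes refl = Even-triangle G tf ab fg cd (Even-swap ((a , b) ∷ []) (c , d) (a , g) [] ev)
... | no a≢f with a ≟ g
... | yes refl = Even-triangle G tf ab (Adj-sym G fg) cd
                   (Even-reverse ((a , b) ∷ []) f a _ (Even-swap ((a , b) ∷ []) (c , d) (f , a) [] ev))
... | no a≢g = pendant-¬Even (Adj⇒≢ G ab) ((a≢c , a≢d) ∷ (a≢f , a≢g) ∷ []) ev

IsEdge : (G : Graph) → Edge (n G) → Set
IsEdge G (i , j) = toℕ i < toℕ j × Adj G i j

¬Even-short : ∀ G → TriangleFree G → ∀ {e S} → Unique (e ∷ S) → All (IsEdge G) (e ∷ S) →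
              length S < 3 → ¬ Even (e ∷ S)
¬Even-short G tf {a , b} {[]} _ ((_ , ab) ∷ []) _ ev = pendant-¬Even (Adj⇒≢ G ab) [] ev
¬Even-short G tf {a , b} {(c , d) ∷ []} ((e≢e′ ∷ []) ∷ _) ((a<b , ab) ∷ (c<d , _) ∷ []) _ ev
  with Even-pair (Adj⇒≢ G ab) ev
... | inj₁ e≡e′ = e≢e′ e≡e′
... | inj₂ refl = <-asym a<b c<d
¬Even-short G tf {a , b} {(c , d) ∷ (f , g) ∷ []} _ ((_ , ab) ∷ (_ , cd) ∷ (_ , fg) ∷ []) _ ev =
  Even-three-edges G tf ab cd fg ev
¬Even-short G tf {S = _ ∷ _ ∷ _ ∷ _} _ _ (s<s (s<s (s<s ())))

Unique-resp-⊆ : ∀ {A : Set} {S L : List A} → S ⊆ L → Unique L → Unique S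
Unique-resp-⊆ []         []          = []
Unique-resp-⊆ (_ ∷ʳ S⊆L) (_ ∷ L!)    = Unique-resp-⊆ S⊆L L!
Unique-resp-⊆ (refl ∷ S⊆L) (x∉L ∷ L!) = All-resp-⊆ S⊆L x∉L ∷ Unique-resp-⊆ S⊆L L!

All-concatMap : ∀ {A B : Set} {P : B → Set} (f : A → List B) → (∀ x → All P (f x)) →
                ∀ xs → All P (concatMap f xs)
All-concatMap f Pf xs = Allₚ.concat⁺ (Allₚ.map⁺ {f = f} (All.universal Pf xs))

-- blocks of a concatenation are disjoint when each element records which block it came from
concatMap-Unique : ∀ {A B : Set} (tag : B → A) {f : A → List B} →
                   (∀ x → All (λ y → tag y ≡ x) (f x)) → (∀ x → Unique (f x)) →
                   ∀ {xs} → Unique xs → Unique (concatMap f xs)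
concatMap-Unique tag {f} tagged f! {xs} xs! =
  Unique.concat⁺ (Allₚ.map⁺ (All.universal f! xs)) (AllPairsₚ.map⁺ (AllPairs.map disjoint xs!))
  where
  disjoint : ∀ {x x′} → x ≢ x′ → Disjoint (f x) (f x′)
  disjoint {x} {x′} x≢x′ (y∈fx , y∈fx′) =
    x≢x′ (trans (sym (All.lookup (tagged x) y∈fx)) (All.lookup (tagged x′) y∈fx′))

module _ (G : Graph) where

  private
    cell : Fin (n G) → Fin (n G) → List (Edge (n G))
    cell i j = if (toℕ i <ᵇ toℕ j) ∧ adj G i j then (i , j) ∷ [] else []

    cell-IsEdge : ∀ i j → All (IsEdge G) (cell i j)
    cell-IsEdge i j with toℕ i <ᵇ toℕ j in i<ᵇj | adj G i j in ij
    ... | true  | true  = (<ᵇ⇒< (toℕ i) (toℕ j) (subst T (sym i<ᵇj) _) , ij) ∷ []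
    ... | true  | false = []
    ... | false | _     = []

    cell-Unique : ∀ i j → Unique (cell i j)
    cell-Unique i j with (toℕ i <ᵇ toℕ j) ∧ adj G i j
    ... | true  = [] ∷ []
    ... | false = []

    cell-≡ : ∀ i j → All (_≡ (i , j)) (cell i j)
    cell-≡ i j with (toℕ i <ᵇ toℕ j) ∧ adj G i j
    ... | true  = refl ∷ []
    ... | false = []

    row : Fin (n G) → List (Edge (n G))
    row i = concatMap (cell i) (allFin (n G))

    row-first : ∀ i → All (λ e → proj₁ e ≡ i) (row i)
    row-first i = All-concatMap (cell i) (λ j → All.map (cong proj₁) (cell-≡ i j)) (allFin (n G))

  edges-IsEdge : All (IsEdge G) (edges G)
  edges-IsEdge =
    All-concatMap row (λ i → All-concatMap (cell i) (cell-IsEdge i) (allFin (n G))) (allFin (n G))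

  edges-Unique : Unique (edges G)
  edges-Unique = concatMap-Unique proj₁ {row} row-first
    (λ i → concatMap-Unique proj₂ {cell i} (λ j → All.map (cong proj₂) (cell-≡ i j)) (cell-Unique i)
                            (Unique.allFin⁺ (n G)))
    (Unique.allFin⁺ (n G))

edges-NoShortEvenSublist : ∀ G → TriangleFree G → NoShortEvenSublist (edges G)
edges-NoShortEvenSublist G tf eS⊆E =
  ¬Even-short G tf (Unique-resp-⊆ eS⊆E (edges-Unique G)) (All-resp-⊆ eS⊆E (edges-IsEdge G))

truncate-tU : ∀ G → truncate (tU G) ≡ weight (edges G) ∅
truncate-tU G = begin
  truncate (tU G)
    ≡⟨ truncate-scaleP (halfPow (n G)) (sumAssign (n G) edge-product) ⟩
  halfPow (n G) ·₄ truncate (sumAssign (n G) edge-product)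
    ≡⟨ cong (halfPow (n G) ·₄_)
            (trans (truncate-sumAssign (n G) edge-product) (Σ₄-cong (n G) truncate-edge-product)) ⟩
  mean (n G) (λ σ → signed (χ ∅ σ) (U-product σ (edges G)))
    ≡⟨ mean-U-product (n G) (edges G) ∅ ⟩
  weight (edges G) ∅ ∎
  where
  open ≡-Reasoning
  edge-product : (Fin (n G) → Bool) → Poly
  edge-product σ = prodP (map (λ { (i , j) → Uval (σ i) (σ j) }) (edges G))
  truncate-edge-product : ∀ σ → truncate (edge-product σ) ≡ signed (χ ∅ σ) (U-product σ (edges G))
  truncate-edge-product σ = trans (truncate-prodP σ _ (λ i j → truncate-Uval (σ i) (σ j)) (edges G))
                                  (cong (λ s → signed s (U-product σ (edges G))) (sym (χ-∅ σ)))

truncate-Δ : ∀ H → TriangleFree H → truncate (Δ H) ≡ 0₄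
truncate-Δ H tf = begin
  truncate (Δ H)
    ≡⟨ truncate-addP (tU H) (scaleP (- 1ℚ) (powP p-1 (e H))) ⟩
  truncate (tU H) +₄ truncate (scaleP (- 1ℚ) (powP p-1 (e H)))
    ≡⟨ cong₂ _+₄_ (trans (truncate-tU H) (weight-∅ (edges H) (edges-NoShortEvenSublist H tf)))
                  (trans (truncate-scaleP (- 1ℚ) (powP p-1 (e H)))
                         (cong ((- 1ℚ) ·₄_) (truncate-powP p-1 (e H)))) ⟩
  X₄-1 ^₄ e H +₄ (- 1ℚ) ·₄ X₄-1 ^₄ e H
    ≡⟨ +-inverseʳ₄ (X₄-1 ^₄ e H) ⟩
  0₄ ∎
  where
  open ≡-Reasoning
  p-1 = - 1ℚ ∷ 1ℚ ∷ []

lemma4p1 : (H : Graph) → TriangleFree H → powP X 4 ∣P Δ H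
lemma4p1 H tf = truncate≡0₄⇒X⁴∣P (Δ H) (truncate-Δ H tf)
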